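{- Let $v,d\ge0$ and let $\langle\mathbf{S}'\rangle,\langle\mathbf{S}''\rangle\in\mathbf{E}\langle v,d\rangle$ be characteristic minmatrices. Then: (a) $\langle\mathbf{S}'\rangle\vee\langle\mathbf{S}''\rangle=\langle\mathbf{S}'\rangle\cup\langle\mathbf{S}''\rangle$ (in particular the union is a characteristic minmatrix); (b) $\langle\mathbf{S}'\rangle\wedge\langle\mathbf{S}''\rangle\subseteq\langle\mathbf{S}'\rangle\cap\langle\mathbf{S}''\rangle$.
   Context: Language: variables $p_1,p_2,\dots$, constants $0,1$, connectives $\neg,\vee,\wedge$, modal operator $\lozenge$. $\mathbf{E}$ is the smallest set of formulas containing all tautologies and closed under modus ponens, uniform substitution and RE (from $\varphi\leftrightarrow\psi$ infer $\lozenge\varphi\leftrightarrow\lozenge\psi$); a classical modal logic is a set of formulas containing $\mathbf{E}$ closed under these rules. $\varphi\approx\psi$ means $\vdash_{\mathbf{E}}\varphi\leftrightarrow\psi$. $\mathcal{F}(v,d)$: formulas in $p_1,\dots,p_v$ of $\lozenge$-depth $\le d$. DCF: level-0 minterms are $\pm p_1\wedge\dots\wedge\pm p_v$; for $d\ge1$ the level-$d$ modal factors are $\lozenge\phi$ for all DCF formulas $\phi$ of $\mathcal{F}(v,d-1)$, and a level-$d$ minterm is a level-0 minterm conjoined with every level-$d$ modal factor, each plain or negated; DCF formulas of $\mathcal{F}(v,d)$ are disjunctions of sets of distinct level-$d$ minterms. Every formula of $\mathcal{F}(v,d)$ is $\approx$ to exactly one DCF formula, so each element of $\mathbf{E}[v,d]=\mathcal{F}(v,d)/\approx$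 (a "minmatrix") is identified with a set of level-$d$ minterms; disjunction/conjunction correspond to union/intersection, and $\vdash_{\mathbf{E}}\varphi\to\psi$ iff the minterm set of $\varphi$ is contained in that of $\psi$. For a classical modal logic $\mathbf{S}$, the characteristic minmatrix $\langle\mathbf{S}\rangle=\langle\mathbf{S}\rangle_{v,d}$ is the intersection of the minterm sets of all $\mathbf{S}$-theorems in $\mathcal{F}(v,d)$. $\mathbf{E}\langle v,d\rangle$ is the set of all characteristic minmatrices, ordered by inclusion, regarded as a lattice; $\vee$ and $\wedge$ denote its join and meet (the least upper bound and greatest lower bound within $\mathbf{E}\langle v,d\rangle$). -}

module Defs where

open import Data.Nat using (ℕ; zero; suc; _<_; _≤_; _⊔_)
open import Data.Bool using (Bool; true; false; not; _∧_; _∨_)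
open import Data.Product using (Σ; _×_)
open import Data.Unit using (⊤)
open import Level using (Level) renaming (suc to lsuc; zero to lzero)
open import Relation.Binary.PropositionalEquality using (_≡_)

-- Formulas: variable p_(i+1) is `var i`; constants 0,1; ¬, ∨, ∧, ◇.
data Formula : Set where
  var  : ℕ → Formula
  𝟘 𝟙  : Formula
  ¬'   : Formula → Formula
  _∨'_ : Formula → Formula → Formula
  _∧'_ : Formula → Formula → Formula
  ◇    : Formula → Formula

infixr 4 _⇒_ _⇔_
_⇒_ : Formula → Formula → Formula
φ ⇒ ψ = ¬' φ ∨' ψ

_⇔_ : Formula → Formula → Formula
φ ⇔ ψ = (φ ⇒ ψ) ∧' (ψ ⇒ φ)

-- Classical (Boolean) evaluation, with formulas ◇ψ treated as atoms.
eval : (ℕ → Bool) → (Formula → Bool) → Formula → Bool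
eval a m (var i)  = a i
eval a m 𝟘        = false
eval a m 𝟙        = true
eval a m (¬' φ)   = not (eval a m φ)
eval a m (φ ∨' ψ) = eval a m φ ∨ eval a m ψ
eval a m (φ ∧' ψ) = eval a m φ ∧ eval a m ψ
eval a m (◇ φ)    = m (◇ φ)

Tautology : Formula → Set
Tautology φ = ∀ (a : ℕ → Bool) (m : Formula → Bool) → eval a m φ ≡ true

subst : (ℕ → Formula) → Formula → Formula
subst σ (var i)  = σ i
subst σ 𝟘        = 𝟘
subst σ 𝟙        = 𝟙
subst σ (¬' φ)   = ¬' (subst σ φ)
subst σ (φ ∨' ψ) = subst σ φ ∨' subst σ ψ
subst σ (φ ∧' ψ) = subst σ φ ∧' subst σ ψ
subst σ (◇ φ)    = ◇ (subst σ φ)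

data ⊢E : Formula → Set where
  taut : ∀ {φ} → Tautology φ → ⊢E φ
  mp   : ∀ {φ ψ} → ⊢E φ → ⊢E (φ ⇒ ψ) → ⊢E ψ
  us   : ∀ {φ} (σ : ℕ → Formula) → ⊢E φ → ⊢E (subst σ φ)
  re   : ∀ {φ ψ} → ⊢E (φ ⇔ ψ) → ⊢E (◇ φ ⇔ ◇ ψ)

record ClassicalModalLogic (S : Formula → Set) : Set where
  field
    containsE : ∀ {φ} → ⊢E φ → S φ
    closedMP  : ∀ {φ ψ} → S φ → S (φ ⇒ ψ) → S ψ
    closedUS  : ∀ {φ} (σ : ℕ → Formula) → S φ → S (subst σ φ)
    closedRE  : ∀ {φ ψ} → S (φ ⇔ ψ) → S (◇ φ ⇔ ◇ ψ)

-- F(v,d): variables among p_1..p_v (i.e. var i with i < v), ◇-depth ≤ d.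
VarsBelow : ℕ → Formula → Set
VarsBelow v (var i)  = i < v
VarsBelow v 𝟘        = ⊤
VarsBelow v 𝟙        = ⊤
VarsBelow v (¬' φ)   = VarsBelow v φ
VarsBelow v (φ ∨' ψ) = VarsBelow v φ × VarsBelow v ψ
VarsBelow v (φ ∧' ψ) = VarsBelow v φ × VarsBelow v ψ
VarsBelow v (◇ φ)    = VarsBelow v φ

depth : Formula → ℕ
depth (var i)  = 0
depth 𝟘        = 0
depth 𝟙        = 0
depth (¬' φ)   = depth φ
depth (φ ∨' ψ) = depth φ ⊔ depth ψ
depth (φ ∧' ψ) = depth φ ⊔ depth ψ
depth (◇ φ)    = suc (depth φ)

InF : ℕ → ℕ → Formula → Set
InF v d φ = VarsBelow v φ × depth φ ≤ d

-- Minmatrices (elements of E[v,d]) are represented by formulas of F(v,d);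
-- inclusion of minterm sets is ⊢E (x ⇒ y), union is ∨', intersection is ∧'.
_⊑_ : Formula → Formula → Set
x ⊑ y = ⊢E (x ⇒ y)

-- χ represents the characteristic minmatrix ⟨S⟩_{v,d}: χ is the intersection
-- (greatest lower bound in E[v,d]) of the minterm sets of all S-theorems in F(v,d).
IsCharOf : (Formula → Set) → ℕ → ℕ → Formula → Set
IsCharOf S v d χ =
  InF v d χ
  × (∀ θ → InF v d θ → S θ → χ ⊑ θ)
  × (∀ ψ → InF v d ψ → (∀ θ → InF v d θ → S θ → ψ ⊑ θ) → ψ ⊑ χ)

Characteristic : ℕ → ℕ → Formula → Set₁
Characteristic v d χ =
  Σ (Formula → Set) (λ S → ClassicalModalLogic S × IsCharOf S v d χ)

IsJoin : ℕ → ℕ → Formula → Formula → Formula → Set₁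
IsJoin v d x y z =
  Characteristic v d z × x ⊑ z × y ⊑ z
  × (∀ w → Characteristic v d w → x ⊑ w → y ⊑ w → z ⊑ w)

IsMeet : ℕ → ℕ → Formula → Formula → Formula → Set₁
IsMeet v d x y z =
  Characteristic v d z × z ⊑ x × z ⊑ y
  × (∀ w → Characteristic v d w → w ⊑ x → w ⊑ y → w ⊑ z)

{-# OPTIONS --safe #-}
-- In the Boolean algebra E[v,d] meets distribute over joins: if x is the meet of the
-- theorems of S' in F(v,d) and y that of S'', then x ∨ y is the meet of all θ' ∨ θ''
-- with θ' ∈ S' and θ'' ∈ S''. Each such disjunction is a theorem of the classical
-- modal logic S' ∩ S'', and every theorem of S' ∩ S'' lies above x ∨ y, so x ∨ y is
-- the characteristic minmatrix of S' ∩ S''. Being the least upper bound of x and y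
-- in all of E[v,d], it is a fortiori their join in E⟨v,d⟩; dually, any meet in
-- E⟨v,d⟩ lies below the meet x ∧ y taken in E[v,d].
module Submission where

open import Defs
open import Data.Nat using (ℕ; zero; suc)
open import Data.Nat.Properties using (⊔-lub)
open import Data.Bool using (Bool; true; false; not; _∧_; _∨_; T)
open import Data.Bool.Properties using (T-∧)
open import Data.Product using (_×_; _,_; proj₁; proj₂)
open import Function.Bundles using (Equivalence)
open import Level using (0ℓ)
open import Relation.Binary.PropositionalEquality using (_≡_; refl)
open import Relation.Unary using (Pred; _∩_)

BoolFun : ℕ → Set
BoolFun zero    = Bool
BoolFun (suc n) = Bool → BoolFun n

Valid : ∀ n → BoolFun n → Set
Valid zero    b = b ≡ true
Valid (suc n) f = ∀ b → Valid n (f b)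

validOnAll : ∀ n → BoolFun n → Bool
validOnAll zero    b = b
validOnAll (suc n) f = validOnAll n (f false) ∧ validOnAll n (f true)

truthTable : ∀ n (f : BoolFun n) → T (validOnAll n f) → Valid n f
truthTable zero    true _ = refl
truthTable (suc n) f    t false = truthTable n (f false) (proj₁ (Equivalence.to T-∧ t))
truthTable (suc n) f    t true  = truthTable n (f true)  (proj₂ (Equivalence.to T-∧ t))

mp₂ : ∀ {φ ψ χ} → ⊢E φ → ⊢E ψ → ⊢E (φ ⇒ ψ ⇒ χ) → ⊢E χ
mp₂ ⊢φ ⊢ψ ⊢φ⇒ψ⇒χ = mp ⊢ψ (mp ⊢φ ⊢φ⇒ψ⇒χ)

x⊑x∨y : ∀ x y → x ⊑ (x ∨' y)
x⊑x∨y x y = taut λ a m → law (eval a m x) (eval a m y)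
  where
  law : ∀ a b → not a ∨ (a ∨ b) ≡ true
  law = truthTable 2 _ _

y⊑x∨y : ∀ x y → y ⊑ (x ∨' y)
y⊑x∨y x y = taut λ a m → law (eval a m x) (eval a m y)
  where
  law : ∀ a b → not b ∨ (a ∨ b) ≡ true
  law = truthTable 2 _ _

∨-least : ∀ {x y z} → x ⊑ z → y ⊑ z → (x ∨' y) ⊑ z
∨-least {x} {y} {z} x⊑z y⊑z =
  mp₂ x⊑z y⊑z (taut λ a m → law (eval a m x) (eval a m y) (eval a m z))
  where
  law : ∀ a b c → not (not a ∨ c) ∨ (not (not b ∨ c) ∨ (not (a ∨ b) ∨ c)) ≡ true
  law = truthTable 3 _ _

∧-greatest : ∀ {x y z} → z ⊑ x → z ⊑ y → z ⊑ (x ∧' y)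
∧-greatest {x} {y} {z} z⊑x z⊑y =
  mp₂ z⊑x z⊑y (taut λ a m → law (eval a m x) (eval a m y) (eval a m z))
  where
  law : ∀ a b c → not (not c ∨ a) ∨ (not (not c ∨ b) ∨ (not c ∨ (a ∧ b))) ≡ true
  law = truthTable 3 _ _

⊑∨⇒∧¬⊑ : ∀ {p t u} → p ⊑ (t ∨' u) → (p ∧' ¬' t) ⊑ u
⊑∨⇒∧¬⊑ {p} {t} {u} p⊑t∨u =
  mp p⊑t∨u (taut λ a m → law (eval a m p) (eval a m t) (eval a m u))
  where
  law : ∀ p t u → not (not p ∨ (t ∨ u)) ∨ (not (p ∧ not t) ∨ u) ≡ true
  law = truthTable 3 _ _

∧¬⊑⇒⊑∨ : ∀ {p t u} → (p ∧' ¬' u) ⊑ t → p ⊑ (t ∨' u)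
∧¬⊑⇒⊑∨ {p} {t} {u} p∧¬u⊑t =
  mp p∧¬u⊑t (taut λ a m → law (eval a m p) (eval a m t) (eval a m u))
  where
  law : ∀ p t u → not (not (p ∧ not u) ∨ t) ∨ (not p ∨ (t ∨ u)) ≡ true
  law = truthTable 3 _ _

InF-∨ : ∀ {v d} φ ψ → InF v d φ → InF v d ψ → InF v d (φ ∨' ψ)
InF-∨ _ _ (vφ , dφ) (vψ , dψ) = (vφ , vψ) , ⊔-lub dφ dψ

InF-∧ : ∀ {v d} φ ψ → InF v d φ → InF v d ψ → InF v d (φ ∧' ψ)
InF-∧ _ _ (vφ , dφ) (vψ , dψ) = (vφ , vψ) , ⊔-lub dφ dψ

UpwardClosed : Pred Formula 0ℓ → Set
UpwardClosed S = ∀ {φ ψ} → S φ → φ ⊑ ψ → S ψ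

upwardClosed : ∀ {S} → ClassicalModalLogic S → UpwardClosed S
upwardClosed L Sφ φ⊑ψ = closedMP Sφ (containsE φ⊑ψ)
  where open ClassicalModalLogic L

∩-classicalModalLogic : ∀ {S' S''} → ClassicalModalLogic S' → ClassicalModalLogic S''
  → ClassicalModalLogic (S' ∩ S'')
∩-classicalModalLogic L' L'' = record
  { containsE = λ ⊢φ → C.containsE L' ⊢φ , C.containsE L'' ⊢φ
  ; closedMP  = λ (s'φ , s''φ) (s'φ⇒ψ , s''φ⇒ψ) →
                  C.closedMP L' s'φ s'φ⇒ψ , C.closedMP L'' s''φ s''φ⇒ψ
  ; closedUS  = λ σ (s' , s'') → C.closedUS L' σ s' , C.closedUS L'' σ s''
  ; closedRE  = λ (s' , s'') → C.closedRE L' s' , C.closedRE L'' s''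
  }
  where module C = ClassicalModalLogic

∩-isCharOf : ∀ {S' S'' : Pred Formula 0ℓ} {v d x y} → UpwardClosed S' → UpwardClosed S''
  → IsCharOf S' v d x → IsCharOf S'' v d y → IsCharOf (S' ∩ S'') v d (x ∨' y)
∩-isCharOf {S'} {S''} {v} {d} {x} {y} up' up''
  (Fx , x⊑S' , x-greatest) (Fy , y⊑S'' , y-greatest) =
  InF-∨ x y Fx Fy , below , greatest
  where
  below : ∀ θ → InF v d θ → (S' ∩ S'') θ → (x ∨' y) ⊑ θ
  below θ Fθ (s' , s'') = ∨-least (x⊑S' θ Fθ s') (y⊑S'' θ Fθ s'')

  greatest : ∀ ψ → InF v d ψ → (∀ θ → InF v d θ → (S' ∩ S'') θ → ψ ⊑ θ) → ψ ⊑ (x ∨' y)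
  greatest ψ Fψ ψ⊑S'∩S'' = ∧¬⊑⇒⊑∨ (x-greatest (ψ ∧' ¬' y) (InF-∧ ψ (¬' y) Fψ Fy) ψ∧¬y⊑S')
    where
    ψ⊑θ'∨θ'' : ∀ {θ' θ''} → InF v d θ' → InF v d θ'' → S' θ' → S'' θ'' → ψ ⊑ (θ' ∨' θ'')
    ψ⊑θ'∨θ'' {θ'} {θ''} Fθ' Fθ'' s' s'' =
      ψ⊑S'∩S'' (θ' ∨' θ'') (InF-∨ θ' θ'' Fθ' Fθ'')
        (up' s' (x⊑x∨y θ' θ'') , up'' s'' (y⊑x∨y θ' θ''))

    -- ψ ∧ ¬θ' lies below every θ'' ∈ S'', hence below y; now trade ¬θ' for ¬y.
    ψ∧¬y⊑S' : ∀ θ' → InF v d θ' → S' θ' → (ψ ∧' ¬' y) ⊑ θ'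
    ψ∧¬y⊑S' θ' Fθ' s' = ⊑∨⇒∧¬⊑ (∧¬⊑⇒⊑∨ (y-greatest (ψ ∧' ¬' θ') (InF-∧ ψ (¬' θ') Fψ Fθ')
      λ θ'' Fθ'' s'' → ⊑∨⇒∧¬⊑ (ψ⊑θ'∨θ'' Fθ' Fθ'' s' s'')))

characteristic-∨ : ∀ {v d x y} → Characteristic v d x → Characteristic v d y
  → Characteristic v d (x ∨' y)
characteristic-∨ (S' , L' , charS') (S'' , L'' , charS'') =
  S' ∩ S'' , ∩-classicalModalLogic L' L''
  , ∩-isCharOf (upwardClosed L') (upwardClosed L'') charS' charS''

theorem2 : (v d : ℕ) (x y : Formula)
    → Characteristic v d x → Characteristic v d y
    → IsJoin v d x y (x ∨' y)
      × (∀ z → IsMeet v d x y z → z ⊑ (x ∧' y))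
theorem2 v d x y charX charY =
  (characteristic-∨ charX charY , x⊑x∨y x y , y⊑x∨y x y , λ _ _ → ∨-least)
  , λ _ (_ , z⊑x , z⊑y , _) → ∧-greatest z⊑x z⊑y
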